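{- Let $M$ be a monoid presented by a finite alphabet $\Sigma$ and a (possibly infinite) set of homogeneous relations of the form $b_1\cdots b_k=c_1\cdots c_k$ with $k\ge 2$ and $b_i,c_i\in\Sigma$, and let $P(M)$ be its associated poset. If for all $A,X,Y\in M$ the equality $AX=AY$ implies $X=Y$, then $P(M)$ is upho.
   Context: The monoid $M$ consists of finite words over $\Sigma$ modulo the congruence generated by the relations (so $A=B$ implies $XAY=XBY$), with concatenation as operation and the empty word as identity. The associated poset $P(M)$ has underlying set $M$, with $X$ covering $Y$ iff $X=Ya$ for some $a\in\Sigma$; the order is the reflexive-transitive closure, so $Y\le X$ iff $X=YZ$ for some $Z\in M$, and the rank of an element is its word length (well-defined since relations are homogeneous). A ranked poset $P$ (disjoint decomposition $P=P_0\sqcup P_1\sqcup\cdots$ with covers increasing rank by exactly one) is upho if every $P_i$ is finite and $V_{P,s}=\{t\in P:t\ge s\}\cong P$ for all $s\in P$. -}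

module Defs where

open import Level using (Level; _⊔_) renaming (suc to lsuc)
open import Data.Nat using (ℕ; suc; _≤_)
open import Data.Fin using (Fin)
open import Data.List using (List; []; _∷_; _++_; length; [_])
open import Data.List.Membership.Propositional using (_∈_)
open import Data.Product using (Σ; ∃; ∃-syntax; _×_; _,_)
open import Relation.Nullary using (¬_)
open import Relation.Binary using (Rel; IsPartialOrder)
open import Relation.Binary.PropositionalEquality using (_≡_)

module _ {a ℓ₁ ℓ₂ : Level} {A : Set a}
         (_≈_ : Rel A ℓ₁) (_≤_ : Rel A ℓ₂) where

  _<_ : Rel A (ℓ₁ ⊔ ℓ₂)
  x < y = (x ≤ y) × ¬ (x ≈ y)

  _⋖_ : Rel A (a ⊔ ℓ₁ ⊔ ℓ₂)
  x ⋖ y = (x < y) × (∀ z → x < z → ¬ (z < y))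

  record IsUpho (rank : A → ℕ) : Set (a ⊔ ℓ₁ ⊔ ℓ₂) where
    field
      isPartialOrder : IsPartialOrder _≈_ _≤_
      rank-resp      : ∀ {x y} → x ≈ y → rank x ≡ rank y
      ranked         : ∀ {x y} → x ⋖ y → rank y ≡ suc (rank x)
      finiteLevels   : ∀ i → ∃[ xs ] (∀ x → rank x ≡ i →
                                         ∃[ y ] (y ∈ xs × (x ≈ y)))
      -- V_{P,s} = {t | t ≥ s} ≅ P for every s: an order isomorphism
      -- f : P → V_{P,s} (order embedding, onto V_{P,s})
      selfSimilar    : ∀ s → Σ (A → A) λ f →
                         (∀ x → s ≤ f x)
                       × (∀ {x y} → x ≈ y → f x ≈ f y)
                       × (∀ x y → (x ≤ y → f x ≤ f y) × (f x ≤ f y → x ≤ y))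
                       × (∀ t → s ≤ t → ∃[ x ] (f x ≈ t))

module Presented {n : ℕ} {r : Level}
                 (R : List (Fin n) → List (Fin n) → Set r) where

  Word : Set
  Word = List (Fin n)

  Homogeneous : Set r
  Homogeneous = ∀ u v → R u v → (length u ≡ length v) × (2 ≤ length u)

  -- the congruence generated by R (equality in M)
  data _~_ : Word → Word → Set r where
    step  : ∀ {u v} x y → R u v → (x ++ u ++ y) ~ (x ++ v ++ y)
    ~refl  : ∀ {u} → u ~ u
    ~sym   : ∀ {u v} → u ~ v → v ~ u
    ~trans : ∀ {u v w} → u ~ v → v ~ w → u ~ w

  _≤M_ : Word → Word → Set r
  Y ≤M X = ∃[ Z ] (X ~ (Y ++ Z))

  LeftCancellative : Set r
  LeftCancellative = ∀ A X Y → (A ++ X) ~ (A ++ Y) → X ~ Y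

  PMIsUpho : Set r
  PMIsUpho = IsUpho _~_ _≤M_ length

{-# OPTIONS --safe #-}
-- Since the relations are homogeneous, word length is an invariant of the
-- congruence, so it is a well-defined rank, a proper prefix is strictly
-- shorter (which gives antisymmetry and forces covers to add one letter),
-- and each rank level is the image of the finitely many words of that
-- length.  Left multiplication by s maps P(M) onto the up-set of s and
-- preserves the order; left cancellation is exactly what makes it reflect
-- the order, so it is an isomorphism P(M) ≅ V_{P,s}.
module Submission where

open import Defs
open import Level using (Level)
open import Data.Nat as ℕ using (ℕ; zero; suc; _+_; s≤s; z≤n)
open import Data.Nat.Properties using (+-comm; m≤m+n; m<m+n; <-irrefl; <-≤-trans)
open import Data.Fin using (Fin)
open import Data.List using (List; []; _∷_; _++_; length; [_]; allFin; cartesianProductWith)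
open import Data.List.Properties using (length-++; ++-assoc; ++-identityʳ)
open import Data.List.Membership.Propositional using (_∈_)
open import Data.List.Membership.Propositional.Properties using (∈-allFin; ∈-cartesianProductWith⁺)
open import Data.List.Relation.Unary.Any using (here)
open import Data.Product using (∃-syntax; _×_; _,_; proj₁)
open import Data.Empty using (⊥-elim)
open import Relation.Binary using (IsEquivalence; IsPreorder; IsPartialOrder)
open import Relation.Binary.PropositionalEquality using (_≡_; refl; sym; trans; cong)
open Relation.Binary.PropositionalEquality.≡-Reasoning

wordsOfLength : ∀ {n} → ℕ → List (List (Fin n))
wordsOfLength zero    = [ [] ]
wordsOfLength (suc i) = cartesianProductWith _∷_ (allFin _) (wordsOfLength i)

∈-wordsOfLength : ∀ {n} (x : List (Fin n)) → x ∈ wordsOfLength (length x)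
∈-wordsOfLength []      = here refl
∈-wordsOfLength (a ∷ x) = ∈-cartesianProductWith⁺ _∷_ (∈-allFin a) (∈-wordsOfLength x)

module _ {n : ℕ} {r : Level} (R : List (Fin n) → List (Fin n) → Set r) where
  open Presented R

  _<M_ : Word → Word → Set r
  _<M_ = _<_ _~_ _≤M_

  _⋖M_ : Word → Word → Set r
  _⋖M_ = _⋖_ _~_ _≤M_

  ≡⇒~ : ∀ {u v} → u ≡ v → u ~ v
  ≡⇒~ refl = ~refl

  ~-isEquivalence : IsEquivalence _~_
  ~-isEquivalence = record { refl = ~refl ; sym = ~sym ; trans = ~trans }

  ++-congˡ : ∀ s {u v} → u ~ v → (s ++ u) ~ (s ++ v)
  ++-congˡ s (step {u} {v} x y ρ) =
    ~trans (≡⇒~ (sym (++-assoc s x (u ++ y))))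
      (~trans (step (s ++ x) y ρ) (≡⇒~ (++-assoc s x (v ++ y))))
  ++-congˡ s ~refl         = ~refl
  ++-congˡ s (~sym p)      = ~sym (++-congˡ s p)
  ++-congˡ s (~trans p q)  = ~trans (++-congˡ s p) (++-congˡ s q)

  ++-congʳ : ∀ s {u v} → u ~ v → (u ++ s) ~ (v ++ s)
  ++-congʳ s (step {u} {v} x y ρ) =
    ~trans (≡⇒~ (reassoc u))
      (~trans (step x (y ++ s) ρ) (≡⇒~ (sym (reassoc v))))
    where
    reassoc : ∀ w → (x ++ w ++ y) ++ s ≡ x ++ w ++ y ++ s
    reassoc w = trans (++-assoc x (w ++ y) s) (cong (x ++_) (++-assoc w y s))
  ++-congʳ s ~refl         = ~refl
  ++-congʳ s (~sym p)      = ~sym (++-congʳ s p)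
  ++-congʳ s (~trans p q)  = ~trans (++-congʳ s p) (++-congʳ s q)

  ≤M-reflexive : ∀ {x y} → x ~ y → x ≤M y
  ≤M-reflexive {x} x~y = [] , ~trans (~sym x~y) (≡⇒~ (sym (++-identityʳ x)))

  ≤M-trans : ∀ {x y z} → x ≤M y → y ≤M z → x ≤M z
  ≤M-trans {x} (Z , y~xZ) (W , z~yW) =
    Z ++ W , ~trans z~yW (~trans (++-congʳ W y~xZ) (≡⇒~ (++-assoc x Z W)))

  ≤M-isPreorder : IsPreorder _~_ _≤M_
  ≤M-isPreorder = record
    { isEquivalence = ~-isEquivalence ; reflexive = ≤M-reflexive ; trans = ≤M-trans }

  prefix-≤M : ∀ s x → s ≤M (s ++ x)
  prefix-≤M s x = x , ~refl

  ≤M-++ˡ : ∀ s {x y} → x ≤M y → (s ++ x) ≤M (s ++ y)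
  ≤M-++ˡ s {x} (Z , y~xZ) = Z , ~trans (++-congˡ s y~xZ) (≡⇒~ (sym (++-assoc s x Z)))

  ≤M-cancelˡ : LeftCancellative → ∀ s {x y} → (s ++ x) ≤M (s ++ y) → x ≤M y
  ≤M-cancelˡ cancel s {x} {y} (Z , sy~sxZ) =
    Z , cancel s y (x ++ Z) (~trans sy~sxZ (≡⇒~ (++-assoc s x Z)))

  finiteLevels : ∀ i → ∃[ xs ] (∀ x → length x ≡ i → ∃[ y ] (y ∈ xs × (x ~ y)))
  finiteLevels i = wordsOfLength i , λ { x refl → x , ∈-wordsOfLength x , ~refl }

  module _ (length-preserving : ∀ {u v} → R u v → length u ≡ length v) where

    ~⇒length≡ : ∀ {u v} → u ~ v → length u ≡ length v
    ~⇒length≡ (step {u} {v} x y ρ) = begin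
      length (x ++ u ++ y)              ≡⟨ length-++ x ⟩
      length x + length (u ++ y)        ≡⟨ cong (length x +_) (length-++ u) ⟩
      length x + (length u + length y)  ≡⟨ cong (λ k → length x + (k + length y)) (length-preserving ρ) ⟩
      length x + (length v + length y)  ≡⟨ cong (length x +_) (length-++ v) ⟨
      length x + length (v ++ y)        ≡⟨ length-++ x ⟨
      length (x ++ v ++ y)              ∎
    ~⇒length≡ ~refl        = refl
    ~⇒length≡ (~sym p)     = sym (~⇒length≡ p)
    ~⇒length≡ (~trans p q) = trans (~⇒length≡ p) (~⇒length≡ q)

    length-extension : ∀ {x y} Z → y ~ (x ++ Z) → length y ≡ length x + length Z
    length-extension {x} Z y~xZ = trans (~⇒length≡ y~xZ) (length-++ x)

    ≤M⇒length≤ : ∀ {x y} → x ≤M y → length x ℕ.≤ length y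
    ≤M⇒length≤ {x} (Z , y~xZ) rewrite length-extension Z y~xZ = m≤m+n (length x) (length Z)

    properPrefix⇒length< : ∀ {x y} a Z → y ~ (x ++ a ∷ Z) → length x ℕ.< length y
    properPrefix⇒length< {x} a Z y~xaZ rewrite length-extension (a ∷ Z) y~xaZ =
      m<m+n (length x) (s≤s z≤n)

    properPrefix⇒<M : ∀ {x y} a Z → y ~ (x ++ a ∷ Z) → x <M y
    properPrefix⇒<M a Z y~xaZ =
        (a ∷ Z , y~xaZ)
      , λ x~y → <-irrefl (~⇒length≡ x~y) (properPrefix⇒length< a Z y~xaZ)

    ≤M-antisym : ∀ {x y} → x ≤M y → y ≤M x → x ~ y
    ≤M-antisym {x} ([] , y~x) _ = ~sym (~trans y~x (≡⇒~ (++-identityʳ x)))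
    ≤M-antisym (a ∷ Z , y~xaZ) y≤x =
      ⊥-elim (<-irrefl refl (<-≤-trans (properPrefix⇒length< a Z y~xaZ) (≤M⇒length≤ y≤x)))

    ≤M-isPartialOrder : IsPartialOrder _~_ _≤M_
    ≤M-isPartialOrder = record { isPreorder = ≤M-isPreorder ; antisym = ≤M-antisym }

    -- A cover x ⋖ y is witnessed by y ~ x Z; Z is neither empty (x ≁ y) nor
    -- longer than one letter a (x < x a < y).
    ⋖M⇒length≡suc : ∀ {x y} → x ⋖M y → length y ≡ suc (length x)
    ⋖M⇒length≡suc {x} ((([] , y~x) , x≁y) , _) =
      ⊥-elim (x≁y (~sym (~trans y~x (≡⇒~ (++-identityʳ x)))))
    ⋖M⇒length≡suc {x} (((a ∷ [] , y~xa) , _) , _) =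
      trans (length-extension [ a ] y~xa) (+-comm (length x) 1)
    ⋖M⇒length≡suc {x} (((a ∷ b ∷ Z , y~xabZ) , _) , nothingBetween) =
      ⊥-elim (nothingBetween (x ++ [ a ]) (properPrefix⇒<M a [] ~refl)
        (properPrefix⇒<M b Z (~trans y~xabZ (≡⇒~ (sym (++-assoc x [ a ] (b ∷ Z)))))))

lemma5p5 : ∀ {r : Level} (n : ℕ) (R : List (Fin n) → List (Fin n) → Set r) →
    Presented.Homogeneous R →
    Presented.LeftCancellative R →
    Presented.PMIsUpho R
lemma5p5 n R homogeneous cancel = record
  { isPartialOrder = ≤M-isPartialOrder R length-preserving
  ; rank-resp      = ~⇒length≡ R length-preserving
  ; ranked         = ⋖M⇒length≡suc R length-preserving
  ; finiteLevels   = finiteLevels R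
  ; selfSimilar    = λ s →
        (s ++_)
      , prefix-≤M R s
      , ++-congˡ R s
      , (λ x y → ≤M-++ˡ R s , ≤M-cancelˡ R cancel s)
      , λ t (Z , t~sZ) → Z , Presented.~sym t~sZ
  }
  where
  length-preserving : ∀ {u v} → R u v → length u ≡ length v
  length-preserving {u} {v} ρ = proj₁ (homogeneous u v ρ)
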